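{- Let $n$, $k$ and $l$ be integers with $1\leq k<l\leq n-1$ and $k+l\leq n$, and let $V_1$ be the set of all $k$-subsets of $[n]$, viewed as vertices of the set-inclusion graph $G(n,k,l)$. Then for each integer $i$ with $\max\{2k-l,0\}\leq i\leq k-1$ and any two vertices $u,v\in V_1$, we have $|u\cap v|=i$ if and only if $|N(u)\cap N(v)|=\binom{n-2k+i}{l-2k+i}$, where $N(w)$ denotes the set of neighbors of $w$ in $G(n,k,l)$.
   Context: For integers $1\leq k<l\leq n-1$, the set-inclusion graph $G(n,k,l)$ is the simple graph whose vertex set consists of all $k$-subsets and all $l$-subsets of $[n]=\{1,\dots,n\}$, two distinct vertices being adjacent iff one of them is contained in the other. -}

module Defs where

open import Data.Nat using (ℕ; zero; suc; _≟_)
open import Data.Bool using (true; false)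
open import Data.List using (List; []; _∷_; map; _++_; filter; length)
open import Data.Vec using (_∷_; [])
open import Data.Product using (_×_; _,_)
open import Data.Sum using (_⊎_)
open import Relation.Nullary using (¬_; Dec; yes; no)
open import Relation.Nullary.Decidable using (_×-dec_; _⊎-dec_; ¬?)
open import Relation.Binary.PropositionalEquality using (_≡_)
open import Data.Fin.Subset using (Subset; _⊆_; ∣_∣; _∩_)
open import Data.Fin.Subset.Properties using (_⊆?_)
import Data.Bool as Bool
open import Data.Vec.Properties using (≡-dec)

allSubsets : (n : ℕ) → List (Subset n)
allSubsets zero = [] ∷ []
allSubsets (suc n) = map (false ∷_) (allSubsets n) ++ map (true ∷_) (allSubsets n)

IsVertex : (n k l : ℕ) → Subset n → Set
IsVertex n k l s = (∣ s ∣ ≡ k) ⊎ (∣ s ∣ ≡ l)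

isVertex? : (n k l : ℕ) → (s : Subset n) → Dec (IsVertex n k l s)
isVertex? n k l s = (∣ s ∣ ≟ k) ⊎-dec (∣ s ∣ ≟ l)

vertices : (n k l : ℕ) → List (Subset n)
vertices n k l = filter (isVertex? n k l) (allSubsets n)

Adjacent : {n : ℕ} → Subset n → Subset n → Set
Adjacent s t = ¬ (s ≡ t) × ((s ⊆ t) ⊎ (t ⊆ s))

adjacent? : {n : ℕ} → (s t : Subset n) → Dec (Adjacent s t)
adjacent? s t = ¬? (≡-dec Bool._≟_ s t) ×-dec ((s ⊆? t) ⊎-dec (t ⊆? s))

nbhd : (n k l : ℕ) → Subset n → List (Subset n)
nbhd n k l u = filter (adjacent? u) (vertices n k l)

commonNbhd : (n k l : ℕ) → Subset n → Subset n → List (Subset n)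
commonNbhd n k l u v = filter (λ w → adjacent? u w ×-dec adjacent? v w) (vertices n k l)

-- Two k-sets are never adjacent to each other, and an l-set is adjacent to a k-set exactly when it
-- contains it, so N(u) ∩ N(v) is the set of l-supersets of u ∪ v. As |u ∪ v| = 2k − |u ∩ v|, its
-- size is C(n − 2k + j, l − 2k + j) with j = |u ∩ v| when 2k ≤ l + j, and 0 otherwise. Finally
-- t ↦ C(n − 2k + t, l − 2k + t) = C(c + x, x), with c = n − l ≥ 1 and x = l − 2k + t, is positive
-- and strictly increasing, so it determines j.
module Submission where

open import Defs
open import Data.Nat using (ℕ; zero; suc; _+_; _∸_; _*_; _≤_; _<_; _⊔_; _≟_; _≤?_; z≤n; s≤s)
open import Data.Nat.Properties
open import Data.Nat.Combinatorics using (_C_; nCk+nC[k+1]≡[n+1]C[k+1])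
open import Data.List using (List; []; _∷_; length; filter; map; _++_)
open import Data.List.Properties using (filter-++; filter-≐; filter-none; length-++; length-map)
open import Data.List.Relation.Unary.All using (universal)
open import Data.Vec using ([]; _∷_; here)
open import Data.Fin.Subset using (Subset; ∣_∣; _∩_; _∪_; _⊆_; inside; outside)
open import Data.Fin.Subset.Properties
  using (_⊆?_; ∣p∣≤n; drop-∷-⊆; in⊆in; out⊆; ⊆-trans; p⊆q⇒∣p∣≤∣q∣; p⊆p∪q; q⊆p∪q; x∈p∪q⁻)
open import Data.Product using (_×_; _,_; map₁)
import Data.Product as Product
open import Data.Sum using (inj₁; inj₂; [_,_])
open import Data.Empty using (⊥-elim)
open import Function using (_∘_; case_of_)
open import Function.Bundles using (_⇔_; mk⇔)
open import Relation.Nullary using (¬_; yes; no)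
open import Relation.Nullary.Decidable using (_×-dec_)
open import Relation.Unary using (Pred; Decidable; _≐_)
open import Relation.Binary.Definitions using (tri<; tri≈; tri>)
open import Relation.Binary.PropositionalEquality hiding ([_])

[m+o]∸[n+o]≡m∸n : ∀ m n o → (m + o) ∸ (n + o) ≡ m ∸ n
[m+o]∸[n+o]≡m∸n m n o = trans (cong₂ _∸_ (+-comm m o) (+-comm n o)) ([m+n]∸[m+o]≡n∸o o m n)

module _ {a p q} {A : Set a} {P : Pred A p} {Q : Pred A q} where

  filter-filter : (P? : Decidable P) (Q? : Decidable Q) (xs : List A) →
    filter Q? (filter P? xs) ≡ filter (λ x → P? x ×-dec Q? x) xs
  filter-filter P? Q? [] = refl
  filter-filter P? Q? (x ∷ xs) with P? x
  ... | no _ = filter-filter P? Q? xs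
  ... | yes _ with Q? x
  ...   | yes _ = cong (x ∷_) (filter-filter P? Q? xs)
  ...   | no _ = filter-filter P? Q? xs

  length-filter-≐ : (P? : Decidable P) (Q? : Decidable Q) → P ≐ Q → (xs : List A) →
    length (filter P? xs) ≡ length (filter Q? xs)
  length-filter-≐ P? Q? P≐Q xs = cong length (filter-≐ P? Q? P≐Q xs)

length-filter-none : ∀ {a p} {A : Set a} {P : Pred A p} (P? : Decidable P) →
  (∀ x → ¬ P x) → (xs : List A) → length (filter P? xs) ≡ 0
length-filter-none P? ¬P xs = cong length (filter-none P? (universal ¬P xs))

filter-map : ∀ {a b p} {A : Set a} {B : Set b} {P : Pred B p} (P? : Decidable P) (f : A → B)
  (xs : List A) → filter P? (map f xs) ≡ map f (filter (P? ∘ f) xs)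
filter-map P? f [] = refl
filter-map P? f (x ∷ xs) with P? (f x)
... | yes _ = cong (f x ∷_) (filter-map P? f xs)
... | no _ = filter-map P? f xs

length-filter-allSubsets : ∀ {p} {n} {P : Pred (Subset (suc n)) p} (P? : Decidable P) →
  length (filter P? (allSubsets (suc n)))
    ≡ length (filter (P? ∘ (outside ∷_)) (allSubsets n))
      + length (filter (P? ∘ (inside ∷_)) (allSubsets n))
length-filter-allSubsets {n = n} P? = begin
    length (filter P? (map (outside ∷_) (allSubsets n) ++ map (inside ∷_) (allSubsets n)))
  ≡⟨ cong length (filter-++ P? (map (outside ∷_) (allSubsets n)) _) ⟩
    length (filter P? (map (outside ∷_) (allSubsets n)) ++ filter P? (map (inside ∷_) (allSubsets n)))
  ≡⟨ length-++ (filter P? (map (outside ∷_) (allSubsets n))) ⟩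
    length (filter P? (map (outside ∷_) (allSubsets n)))
      + length (filter P? (map (inside ∷_) (allSubsets n)))
  ≡⟨ cong₂ _+_ (countMapped (outside ∷_)) (countMapped (inside ∷_)) ⟩
    length (filter (P? ∘ (outside ∷_)) (allSubsets n))
      + length (filter (P? ∘ (inside ∷_)) (allSubsets n)) ∎
  where
  open ≡-Reasoning
  countMapped : (f : Subset n → Subset (suc n)) →
    length (filter P? (map f (allSubsets n))) ≡ length (filter (P? ∘ f) (allSubsets n))
  countMapped f = trans (cong length (filter-map P? f (allSubsets n)))
                        (length-map f (filter (P? ∘ f) (allSubsets n)))

SupersetOfSize : ∀ {n} → Subset n → ℕ → Pred (Subset n) _
SupersetOfSize s m w = s ⊆ w × ∣ w ∣ ≡ m

supersetOfSize? : ∀ {n} (s : Subset n) (m : ℕ) → Decidable (SupersetOfSize s m)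
supersetOfSize? s m w = (s ⊆? w) ×-dec (∣ w ∣ ≟ m)

supersetsOfSize : ∀ {n} → Subset n → ℕ → List (Subset n)
supersetsOfSize {n} s m = filter (supersetOfSize? s m) (allSubsets n)

SupersetOfSize⇒∣s∣≤m : ∀ {n} {s w : Subset n} {m} → SupersetOfSize s m w → ∣ s ∣ ≤ m
SupersetOfSize⇒∣s∣≤m (s⊆w , refl) = p⊆q⇒∣p∣≤∣q∣ s⊆w

length-supersetsOfSize-< : ∀ {n} (s : Subset n) {m} → m < ∣ s ∣ → length (supersetsOfSize s m) ≡ 0
length-supersetsOfSize-< {n} s m<∣s∣ =
  length-filter-none (supersetOfSize? s _)
    (λ w sup → <⇒≱ m<∣s∣ (SupersetOfSize⇒∣s∣≤m sup)) (allSubsets n)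

length-supersetsOfSize+ : ∀ {n} (s : Subset n) (d : ℕ) →
  length (supersetsOfSize s (d + ∣ s ∣)) ≡ (n ∸ ∣ s ∣) C d
length-supersetsOfSize+ {zero} [] zero = refl
length-supersetsOfSize+ {zero} [] (suc d) = refl
length-supersetsOfSize+ {suc n} (inside ∷ s) d rewrite +-suc d ∣ s ∣ = begin
    length (supersetsOfSize (inside ∷ s) (suc (d + ∣ s ∣)))
  ≡⟨ length-filter-allSubsets (supersetOfSize? (inside ∷ s) _) ⟩
    length (filter (supersetOfSize? (inside ∷ s) _ ∘ (outside ∷_)) (allSubsets n))
      + length (filter (supersetOfSize? (inside ∷ s) _ ∘ (inside ∷_)) (allSubsets n))
  ≡⟨ cong₂ _+_
       (length-filter-none _ (λ w (s⊆w , _) → case s⊆w here of λ ()) (allSubsets n))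
       (length-filter-≐ _ (supersetOfSize? s (d + ∣ s ∣))
         (Product.map drop-∷-⊆ suc-injective , Product.map in⊆in (cong suc)) (allSubsets n)) ⟩
    length (supersetsOfSize s (d + ∣ s ∣))
  ≡⟨ length-supersetsOfSize+ s d ⟩
    (n ∸ ∣ s ∣) C d ∎
  where open ≡-Reasoning
length-supersetsOfSize+ {suc n} (outside ∷ s) d = begin
    length (supersetsOfSize (outside ∷ s) (d + ∣ s ∣))
  ≡⟨ length-filter-allSubsets (supersetOfSize? (outside ∷ s) (d + ∣ s ∣)) ⟩
    length (filter (supersetOfSize? (outside ∷ s) (d + ∣ s ∣) ∘ (outside ∷_)) (allSubsets n))
      + length (filter (supersetOfSize? (outside ∷ s) (d + ∣ s ∣) ∘ (inside ∷_)) (allSubsets n))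
  ≡⟨ cong (_+ length (filter (supersetOfSize? (outside ∷ s) (d + ∣ s ∣) ∘ (inside ∷_)) (allSubsets n)))
       (length-filter-≐ _ (supersetOfSize? s (d + ∣ s ∣)) (map₁ drop-∷-⊆ , map₁ out⊆) (allSubsets n)) ⟩
    length (supersetsOfSize s (d + ∣ s ∣))
      + length (filter (supersetOfSize? (outside ∷ s) (d + ∣ s ∣) ∘ (inside ∷_)) (allSubsets n))
  ≡⟨ cong₂ _+_ (length-supersetsOfSize+ s d) (withNewElement d) ⟩
    (n ∸ ∣ s ∣) C d + newElementCount d
  ≡⟨ pascal d ⟩
    (suc n ∸ ∣ s ∣) C d ∎
  where
  open ≡-Reasoning
  newElementCount : ℕ → ℕ
  newElementCount zero = 0
  newElementCount (suc d) = (n ∸ ∣ s ∣) C d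
  withNewElement : ∀ d → length (filter (supersetOfSize? (outside ∷ s) (d + ∣ s ∣) ∘ (inside ∷_))
                                        (allSubsets n)) ≡ newElementCount d
  withNewElement zero = length-filter-none _
    (λ w (s⊆w , 1+∣w∣≡∣s∣) → <⇒≱ (≤-reflexive 1+∣w∣≡∣s∣) (p⊆q⇒∣p∣≤∣q∣ (drop-∷-⊆ s⊆w))) (allSubsets n)
  withNewElement (suc d) = trans
    (length-filter-≐ _ (supersetOfSize? s (d + ∣ s ∣))
      (Product.map drop-∷-⊆ suc-injective , Product.map out⊆ (cong suc)) (allSubsets n))
    (length-supersetsOfSize+ s d)
  pascal : ∀ d → (n ∸ ∣ s ∣) C d + newElementCount d ≡ (suc n ∸ ∣ s ∣) C d
  pascal zero = refl
  pascal (suc d) = begin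
      (n ∸ ∣ s ∣) C suc d + (n ∸ ∣ s ∣) C d
    ≡⟨ +-comm ((n ∸ ∣ s ∣) C suc d) _ ⟩
      (n ∸ ∣ s ∣) C d + (n ∸ ∣ s ∣) C suc d
    ≡⟨ nCk+nC[k+1]≡[n+1]C[k+1] (n ∸ ∣ s ∣) d ⟩
      suc (n ∸ ∣ s ∣) C suc d
    ≡⟨ cong (_C suc d) (+-∸-assoc 1 (∣p∣≤n s)) ⟨
      (suc n ∸ ∣ s ∣) C suc d ∎

length-supersetsOfSize : ∀ {n} (s : Subset n) {m} → ∣ s ∣ ≤ m →
  length (supersetsOfSize s m) ≡ (n ∸ ∣ s ∣) C (m ∸ ∣ s ∣)
length-supersetsOfSize s {m} ∣s∣≤m =
  trans (cong (length ∘ supersetsOfSize s) (sym (m∸n+n≡m ∣s∣≤m))) (length-supersetsOfSize+ s (m ∸ ∣ s ∣))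

∣p∪q∣+∣p∩q∣≡∣p∣+∣q∣ : ∀ {n} (p q : Subset n) → ∣ p ∪ q ∣ + ∣ p ∩ q ∣ ≡ ∣ p ∣ + ∣ q ∣
∣p∪q∣+∣p∩q∣≡∣p∣+∣q∣ [] [] = refl
∣p∪q∣+∣p∩q∣≡∣p∣+∣q∣ (inside ∷ p) (inside ∷ q) =
  cong suc (trans (+-suc _ _) (trans (cong suc (∣p∪q∣+∣p∩q∣≡∣p∣+∣q∣ p q)) (sym (+-suc _ _))))
∣p∪q∣+∣p∩q∣≡∣p∣+∣q∣ (inside ∷ p) (outside ∷ q) = cong suc (∣p∪q∣+∣p∩q∣≡∣p∣+∣q∣ p q)
∣p∪q∣+∣p∩q∣≡∣p∣+∣q∣ (outside ∷ p) (inside ∷ q) =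
  trans (cong suc (∣p∪q∣+∣p∩q∣≡∣p∣+∣q∣ p q)) (sym (+-suc _ _))
∣p∪q∣+∣p∩q∣≡∣p∣+∣q∣ (outside ∷ p) (outside ∷ q) = ∣p∪q∣+∣p∩q∣≡∣p∣+∣q∣ p q

p⊆r∧q⊆r⇒p∪q⊆r : ∀ {n} {p q r : Subset n} → p ⊆ r → q ⊆ r → p ∪ q ⊆ r
p⊆r∧q⊆r⇒p∪q⊆r {p = p} {q} p⊆r q⊆r x∈p∪q = [ p⊆r , q⊆r ] (x∈p∪q⁻ p q x∈p∪q)

p⊆q∧∣q∣≤∣p∣⇒p≡q : ∀ {n} {p q : Subset n} → p ⊆ q → ∣ q ∣ ≤ ∣ p ∣ → p ≡ q
p⊆q∧∣q∣≤∣p∣⇒p≡q {p = []} {[]} _ _ = refl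
p⊆q∧∣q∣≤∣p∣⇒p≡q {p = inside ∷ p} {inside ∷ q} p⊆q (s≤s ∣q∣≤∣p∣) =
  cong (inside ∷_) (p⊆q∧∣q∣≤∣p∣⇒p≡q (drop-∷-⊆ p⊆q) ∣q∣≤∣p∣)
p⊆q∧∣q∣≤∣p∣⇒p≡q {p = inside ∷ p} {outside ∷ q} p⊆q _ = case p⊆q here of λ ()
p⊆q∧∣q∣≤∣p∣⇒p≡q {p = outside ∷ p} {inside ∷ q} p⊆q ∣q∣<∣p∣ =
  ⊥-elim (<⇒≱ ∣q∣<∣p∣ (p⊆q⇒∣p∣≤∣q∣ (drop-∷-⊆ p⊆q)))
p⊆q∧∣q∣≤∣p∣⇒p≡q {p = outside ∷ p} {outside ∷ q} p⊆q ∣q∣≤∣p∣ =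
  cong (outside ∷_) (p⊆q∧∣q∣≤∣p∣⇒p≡q (drop-∷-⊆ p⊆q) ∣q∣≤∣p∣)

module _ {n} {s t : Subset n} where

  ¬Adjacent-sameSize : ∣ s ∣ ≡ ∣ t ∣ → ¬ Adjacent s t
  ¬Adjacent-sameSize ∣s∣≡∣t∣ (s≢t , inj₁ s⊆t) = s≢t (p⊆q∧∣q∣≤∣p∣⇒p≡q s⊆t (≤-reflexive (sym ∣s∣≡∣t∣)))
  ¬Adjacent-sameSize ∣s∣≡∣t∣ (s≢t , inj₂ t⊆s) = s≢t (sym (p⊆q∧∣q∣≤∣p∣⇒p≡q t⊆s (≤-reflexive ∣s∣≡∣t∣)))

  Adjacent-<⇒⊆ : ∣ s ∣ < ∣ t ∣ → Adjacent s t → s ⊆ t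
  Adjacent-<⇒⊆ _ (_ , inj₁ s⊆t) = s⊆t
  Adjacent-<⇒⊆ ∣s∣<∣t∣ (_ , inj₂ t⊆s) = ⊥-elim (<⇒≱ ∣s∣<∣t∣ (p⊆q⇒∣p∣≤∣q∣ t⊆s))

  ⊆∧<⇒Adjacent : s ⊆ t → ∣ s ∣ < ∣ t ∣ → Adjacent s t
  ⊆∧<⇒Adjacent s⊆t ∣s∣<∣t∣ = (λ s≡t → <⇒≢ ∣s∣<∣t∣ (cong ∣_∣ s≡t)) , inj₁ s⊆t

module _ {n k l : ℕ} {u v : Subset n} (∣u∣≡k : ∣ u ∣ ≡ k) (∣v∣≡k : ∣ v ∣ ≡ k) (k<l : k < l) where

  private
    k-set<l-set : (s w : Subset n) → ∣ s ∣ ≡ k → ∣ w ∣ ≡ l → ∣ s ∣ < ∣ w ∣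
    k-set<l-set _ _ ∣s∣≡k ∣w∣≡l = subst₂ _<_ (sym ∣s∣≡k) (sym ∣w∣≡l) k<l

  commonNeighbour≐supersetOfSize :
    (λ w → IsVertex n k l w × (Adjacent u w × Adjacent v w)) ≐ SupersetOfSize (u ∪ v) l
  commonNeighbour≐supersetOfSize = forward , backward
    where
    forward : ∀ {w} → IsVertex n k l w × (Adjacent u w × Adjacent v w) → SupersetOfSize (u ∪ v) l w
    forward (inj₁ ∣w∣≡k , u~w , _) = ⊥-elim (¬Adjacent-sameSize (trans ∣u∣≡k (sym ∣w∣≡k)) u~w)
    forward {w} (inj₂ ∣w∣≡l , u~w , v~w) =
      p⊆r∧q⊆r⇒p∪q⊆r (Adjacent-<⇒⊆ (k-set<l-set u w ∣u∣≡k ∣w∣≡l) u~w)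
                     (Adjacent-<⇒⊆ (k-set<l-set v w ∣v∣≡k ∣w∣≡l) v~w) ,
      ∣w∣≡l
    backward : ∀ {w} → SupersetOfSize (u ∪ v) l w → IsVertex n k l w × (Adjacent u w × Adjacent v w)
    backward {w} (u∪v⊆w , ∣w∣≡l) =
      inj₂ ∣w∣≡l ,
      ⊆∧<⇒Adjacent (⊆-trans (p⊆p∪q v) u∪v⊆w) (k-set<l-set u w ∣u∣≡k ∣w∣≡l) ,
      ⊆∧<⇒Adjacent (⊆-trans (q⊆p∪q u v) u∪v⊆w) (k-set<l-set v w ∣v∣≡k ∣w∣≡l)

  length-commonNbhd≡length-supersetsOfSize :
    length (commonNbhd n k l u v) ≡ length (supersetsOfSize (u ∪ v) l)
  length-commonNbhd≡length-supersetsOfSize = begin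
      length (commonNbhd n k l u v)
    ≡⟨ cong length (filter-filter (isVertex? n k l) (λ w → adjacent? u w ×-dec adjacent? v w) (allSubsets n)) ⟩
      length (filter (λ w → isVertex? n k l w ×-dec (adjacent? u w ×-dec adjacent? v w)) (allSubsets n))
    ≡⟨ length-filter-≐ _ (supersetOfSize? (u ∪ v) l) commonNeighbour≐supersetOfSize (allSubsets n) ⟩
      length (supersetsOfSize (u ∪ v) l) ∎
    where open ≡-Reasoning

  ∣u∪v∣+∣u∩v∣≡2k : ∣ u ∪ v ∣ + ∣ u ∩ v ∣ ≡ 2 * k
  ∣u∪v∣+∣u∩v∣≡2k = begin
      ∣ u ∪ v ∣ + ∣ u ∩ v ∣ ≡⟨ ∣p∪q∣+∣p∩q∣≡∣p∣+∣q∣ u v ⟩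
      ∣ u ∣ + ∣ v ∣         ≡⟨ cong₂ _+_ ∣u∣≡k ∣v∣≡k ⟩
      k + k                 ≡⟨ cong (k +_) (+-identityʳ k) ⟨
      2 * k                 ∎
    where open ≡-Reasoning

  length-commonNbhd : ∀ {j} → ∣ u ∩ v ∣ ≡ j → 2 * k ≤ l + j →
    length (commonNbhd n k l u v) ≡ ((n + j) ∸ 2 * k) C ((l + j) ∸ 2 * k)
  length-commonNbhd {j} refl 2k≤l+j = begin
      length (commonNbhd n k l u v)       ≡⟨ length-commonNbhd≡length-supersetsOfSize ⟩
      length (supersetsOfSize (u ∪ v) l)  ≡⟨ length-supersetsOfSize (u ∪ v) ∣u∪v∣≤l ⟩
      (n ∸ ∣ u ∪ v ∣) C (l ∸ ∣ u ∪ v ∣)   ≡⟨ cong₂ _C_ (shift n) (shift l) ⟩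
      ((n + j) ∸ 2 * k) C ((l + j) ∸ 2 * k) ∎
    where
    open ≡-Reasoning
    ∣u∪v∣≤l : ∣ u ∪ v ∣ ≤ l
    ∣u∪v∣≤l = +-cancelʳ-≤ j (∣ u ∪ v ∣) l (subst (_≤ l + j) (sym ∣u∪v∣+∣u∩v∣≡2k) 2k≤l+j)
    shift : ∀ m → m ∸ ∣ u ∪ v ∣ ≡ (m + j) ∸ 2 * k
    shift m = trans (sym ([m+o]∸[n+o]≡m∸n m ∣ u ∪ v ∣ j)) (cong ((m + j) ∸_) ∣u∪v∣+∣u∩v∣≡2k)

  length-commonNbhd-< : l + ∣ u ∩ v ∣ < 2 * k → length (commonNbhd n k l u v) ≡ 0
  length-commonNbhd-< l+j<2k = trans length-commonNbhd≡length-supersetsOfSize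
    (length-supersetsOfSize-< (u ∪ v)
      (+-cancelʳ-< (∣ u ∩ v ∣) l (∣ u ∪ v ∣) (subst (l + ∣ u ∩ v ∣ <_) (sym ∣u∪v∣+∣u∩v∣≡2k) l+j<2k)))

nCk>0 : ∀ {n k} → k ≤ n → 0 < n C k
nCk>0 {n} {zero} _ = s≤s z≤n
nCk>0 {suc n} {suc k} (s≤s k≤n) =
  subst (0 <_) (nCk+nC[k+1]≡[n+1]C[k+1] n k) (<-≤-trans (nCk>0 k≤n) (m≤m+n _ _))

[c+x]Cx<[c+1+x]C[1+x] : ∀ {c} x → 0 < c → (c + x) C x < (c + suc x) C suc x
[c+x]Cx<[c+1+x]C[1+x] {c} x 0<c = begin-strict
    (c + x) C x                       <⟨ m<m+n _ (nCk>0 (+-monoˡ-≤ x 0<c)) ⟩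
    (c + x) C x + (c + x) C suc x     ≡⟨ nCk+nC[k+1]≡[n+1]C[k+1] (c + x) x ⟩
    suc (c + x) C suc x               ≡⟨ cong (_C suc x) (+-suc c x) ⟨
    (c + suc x) C suc x               ∎
  where open ≤-Reasoning

[c+x]Cx-strictMono : ∀ {c x y} → 0 < c → x < y → (c + x) C x < (c + y) C y
[c+x]Cx-strictMono {y = suc y} 0<c (s≤s x≤y) with m≤n⇒m<n∨m≡n x≤y
... | inj₁ x<y = <-trans ([c+x]Cx-strictMono 0<c x<y) ([c+x]Cx<[c+1+x]C[1+x] y 0<c)
... | inj₂ refl = [c+x]Cx<[c+1+x]C[1+x] y 0<c

[c+x]Cx-injective : ∀ {c x y} → 0 < c → (c + x) C x ≡ (c + y) C y → x ≡ y
[c+x]Cx-injective {x = x} {y} 0<c eq with <-cmp x y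
... | tri< x<y _ _ = ⊥-elim (<⇒≢ ([c+x]Cx-strictMono 0<c x<y) eq)
... | tri≈ _ x≡y _ = x≡y
... | tri> _ _ y<x = ⊥-elim (<⇒≢ ([c+x]Cx-strictMono 0<c y<x) (sym eq))

module _ {n l K : ℕ} where

  [n+t]∸K≡[n∸l]+[[l+t]∸K] : ∀ {t} → l ≤ n → K ≤ l + t → (n + t) ∸ K ≡ (n ∸ l) + ((l + t) ∸ K)
  [n+t]∸K≡[n∸l]+[[l+t]∸K] {t} l≤n K≤l+t = begin
      (n + t) ∸ K             ≡⟨ cong (λ m → (m + t) ∸ K) (m∸n+n≡m l≤n) ⟨
      ((n ∸ l) + l + t) ∸ K   ≡⟨ cong (_∸ K) (+-assoc (n ∸ l) l t) ⟩
      ((n ∸ l) + (l + t)) ∸ K ≡⟨ +-∸-assoc (n ∸ l) K≤l+t ⟩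
      (n ∸ l) + ((l + t) ∸ K) ∎
    where open ≡-Reasoning

  [[n+t]∸K]C[[l+t]∸K]>0 : ∀ t → l ≤ n → 0 < ((n + t) ∸ K) C ((l + t) ∸ K)
  [[n+t]∸K]C[[l+t]∸K]>0 t l≤n = nCk>0 (∸-monoˡ-≤ K (+-monoˡ-≤ t l≤n))

  [[n+t]∸K]C[[l+t]∸K]-injective : ∀ {s t} → l < n → K ≤ l + s → K ≤ l + t →
    ((n + s) ∸ K) C ((l + s) ∸ K) ≡ ((n + t) ∸ K) C ((l + t) ∸ K) → s ≡ t
  [[n+t]∸K]C[[l+t]∸K]-injective {s} {t} l<n K≤l+s K≤l+t eq =
    +-cancelˡ-≡ l s t (∸-cancelʳ-≡ K≤l+s K≤l+t ([c+x]Cx-injective (m<n⇒0<n∸m l<n) diagonalEq))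
    where
    diagonalEq : ((n ∸ l) + ((l + s) ∸ K)) C ((l + s) ∸ K) ≡ ((n ∸ l) + ((l + t) ∸ K)) C ((l + t) ∸ K)
    diagonalEq = subst₂ _≡_
      (cong (_C ((l + s) ∸ K)) ([n+t]∸K≡[n∸l]+[[l+t]∸K] (<⇒≤ l<n) K≤l+s))
      (cong (_C ((l + t) ∸ K)) ([n+t]∸K≡[n∸l]+[[l+t]∸K] (<⇒≤ l<n) K≤l+t))
      eq

lemma3p4 : (n k l : ℕ) → 1 ≤ k → k < l → l ≤ n ∸ 1 → k + l ≤ n →
    (i : ℕ) → (2 * k ∸ l) ⊔ 0 ≤ i → i ≤ k ∸ 1 →
    (u v : Subset n) → ∣ u ∣ ≡ k → ∣ v ∣ ≡ k →
    (∣ u ∩ v ∣ ≡ i ⇔ length (commonNbhd n k l u v) ≡ ((n + i) ∸ 2 * k) C ((l + i) ∸ 2 * k))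
lemma3p4 n k l 1≤k k<l _ k+l≤n i 2k∸l≤i _ u v ∣u∣≡k ∣v∣≡k =
  mk⇔ (λ j≡i → length-commonNbhd ∣u∣≡k ∣v∣≡k k<l j≡i 2k≤l+i) from
  where
  2k≤l+i : 2 * k ≤ l + i
  2k≤l+i = ≤-trans (m≤n+m∸n (2 * k) l) (+-monoʳ-≤ l (subst (_≤ i) (⊔-identityʳ (2 * k ∸ l)) 2k∸l≤i))
  l<n : l < n
  l<n = ≤-trans (+-monoˡ-≤ l 1≤k) k+l≤n
  from : length (commonNbhd n k l u v) ≡ ((n + i) ∸ 2 * k) C ((l + i) ∸ 2 * k) → ∣ u ∩ v ∣ ≡ i
  from eq with 2 * k ≤? l + ∣ u ∩ v ∣
  ... | yes 2k≤l+j = [[n+t]∸K]C[[l+t]∸K]-injective l<n 2k≤l+j 2k≤l+i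
        (trans (sym (length-commonNbhd ∣u∣≡k ∣v∣≡k k<l refl 2k≤l+j)) eq)
  ... | no 2k≰l+j = ⊥-elim (<⇒≢ ([[n+t]∸K]C[[l+t]∸K]>0 {K = 2 * k} i (<⇒≤ l<n))
        (trans (sym (length-commonNbhd-< {u = u} {v = v} ∣u∣≡k ∣v∣≡k k<l (≰⇒> 2k≰l+j))) eq))
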